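{- Let $\mathcal{F}$ be a family of subsets of $\{x_1,\ldots,x_n\}$ and take the order $x_1<x_2<\cdots<x_n$. Suppose there is a linear network model with parameters $a_1=0,a_2,\ldots,a_n$ that decides, for every $S\subseteq\{x_1,\ldots,x_n\}$, whether $S\in\mathcal{F}$. Then $Z_<(\mathcal{F})\le 2+\sum_{i=1}^{n}2^{a_i}$.
   Context: A linear network model for the order $x_1<\cdots<x_n$ consists of $n$ deterministic modules $M_1,\ldots,M_n$. On input $S$, module $M_i$ receives the bit indicating whether $x_i\in S$ together with $a_i$ bits from $M_{i-1}$ (with $a_1=0$, since $M_1$ has no predecessor), and for $i<n$ sends $a_{i+1}$ bits to $M_{i+1}$, these bits being a function of its inputs; the final module $M_n$ outputs one bit, which must indicate whether $S\in\mathcal{F}$. A zero-suppressed binary decision diagram (ZDD) with respect to a total order $<$ on a finite set $U$ is a rooted DAG with two terminal nodes $\top,\bot$ and internal nodes $\mathtt{n}$, each with a label $\mathsf{lb}(\mathtt{n})\in U$ and children $\mathsf{lo}(\mathtt{n}),\mathsf{hi}(\mathtt{n})$, labels strictly increasing along arcs. A node represents: $\{\emptyset\}$ if $\top$, $\emptyset$ if $\bot$, and $\mathcal{F}_{\mathsf{lo}(\mathtt{n})}\cup\{\{\mathsf{lb}(\mathtt{n})\}\cup S\mid S\in\mathcal{F}_{\mathsf{hi}(\mathtt{n})}\}$ otherwise; the ZDD represents the family of its root. The reduced ZDD (obtained by merging nodes with identical label and children and deleting nodes whose hi-child is $\bot$) is the unique smallest ZDD for the family and order; $Z_<(\mathcal{F})$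 is its number of nodes. -}

module Defs where

open import Data.Nat using (ℕ; zero; suc; _+_; _^_; _≤_)
open import Data.Bool using (Bool; true; false)
open import Data.Fin using (Fin; zero; suc) renaming (_<_ to _<ᶠ_)
open import Data.Fin.Subset using (Subset; ⁅_⁆; _∪_) renaming (⊥ to ∅)
open import Data.Vec using (Vec; []; _∷_; tabulate; sum)
open import Data.Product using (Σ; _×_; _,_)
open import Function.Bundles using (_⇔_)
open import Relation.Binary.PropositionalEquality using (_≡_; subst; sym)

-- Ground set {x₁,…,xₙ} is Fin n, with xᵢ < xⱼ iff i < j (order of Fin).
-- A family 𝓕 of subsets is given by its characteristic function
-- Subset n → Bool  (S ∈ 𝓕 iff 𝓕 S ≡ true).

Family : ℕ → Set
Family n = Subset n → Bool

-- Linear network model for n = suc m modules M₁ … Mₙ (0-indexed by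
-- Fin (suc m)).  a i = number of bits module i receives from its
-- predecessor.  Out a i = what module i sends on: a (i+1) bits for a
-- non-final module, a single output bit for the final one.

Out : {m : ℕ} → (Fin (suc m) → ℕ) → Fin (suc m) → Set
Out {zero}  a zero    = Bool
Out {suc m} a zero    = Vec Bool (a (suc zero))
Out {suc m} a (suc i) = Out {m} (λ j → a (suc j)) i

Modules : {m : ℕ} → (Fin (suc m) → ℕ) → Set
Modules {m} a = (i : Fin (suc m)) → Bool → Vec Bool (a i) → Out a i

runFrom : (m : ℕ) (a : Fin (suc m) → ℕ) → Modules a →
          Subset (suc m) → Vec Bool (a zero) → Bool
runFrom zero    a M (s ∷ [])    x = M zero s x
runFrom (suc m) a M (s ∷ S)     x =
  runFrom m (λ j → a (suc j)) (λ i → M (suc i)) S (M zero s x)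

output : (m : ℕ) (a : Fin (suc m) → ℕ) → a zero ≡ 0 → Modules a →
         Subset (suc m) → Bool
output m a a₀ M S = runFrom m a M S (subst (Vec Bool) (sym a₀) [])

Decides : (m : ℕ) (a : Fin (suc m) → ℕ) → a zero ≡ 0 → Modules a →
          Family (suc m) → Set
Decides m a a₀ M 𝓕 = (S : Subset (suc m)) → output m a a₀ M S ≡ 𝓕 S

data Node (k : ℕ) : Set where
  ⊤ₙ  : Node k
  ⊥ₙ  : Node k
  int : Fin k → Node k

record ZDD (n : ℕ) : Set where
  field
    k    : ℕ
    lb   : Fin k → Fin n
    lo   : Fin k → Node k
    hi   : Fin k → Node k
    root : Node k
    lo-ordered : ∀ j j′ → lo j ≡ int j′ → lb j <ᶠ lb j′
    hi-ordered : ∀ j j′ → hi j ≡ int j′ → lb j <ᶠ lb j′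

  nodes : ℕ
  nodes = k + 2

  data _∈ₙ_ : Subset n → Node k → Set where
    mem-⊤  : ∅ ∈ₙ ⊤ₙ
    mem-lo : ∀ {S j} → S ∈ₙ lo j → S ∈ₙ int j
    mem-hi : ∀ {S j} → S ∈ₙ hi j → (⁅ lb j ⁆ ∪ S) ∈ₙ int j

Represents : {n : ℕ} → ZDD n → Family n → Set
Represents {n} Z 𝓕 = (S : Subset n) → (S ∈ₙ root) ⇔ (𝓕 S ≡ true)
  where open ZDD Z

-- Z_<(𝓕) is the size of the reduced ZDD, which is the
-- smallest ZDD for 𝓕 and the order; so Z_<(𝓕) ≤ b says exactly that some
-- ZDD for 𝓕 (w.r.t. the order of Fin n) has at most b nodes.
ZSize≤ : {n : ℕ} → Family n → ℕ → Set
ZSize≤ {n} 𝓕 b = Σ (ZDD n) λ Z → Represents Z 𝓕 × (ZDD.nodes Z ≤ b)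

sumPow2 : {n : ℕ} → (Fin n → ℕ) → ℕ
sumPow2 a = sum (tabulate λ i → 2 ^ a i)

{-# OPTIONS --safe #-}
module Submission where

open import Defs
open import Data.Nat using (ℕ; zero; suc; _+_; _^_; z<s; s<s)
open import Data.Nat.Properties using (+-comm; ≤-reflexive)
open import Data.Bool using (Bool; true; false)
open import Data.Empty using (⊥)
open import Data.Fin using (Fin; zero; suc) renaming (_<_ to _<ᶠ_)
open import Data.Fin.Properties using (0↔⊥; 2↔Bool; +↔⊎; *↔×)
open import Data.Fin.Subset using (Subset; ⁅_⁆; _∪_) renaming (⊥ to ∅)
open import Data.Fin.Subset.Properties using (∪-identityˡ)
open import Data.Vec using (Vec; []; _∷_; head; tail; uncons)
open import Data.Sum using (_⊎_; inj₁; inj₂; [_,_]′)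
open import Data.Product using (Σ; _×_; _,_; uncurry)
open import Data.Product.Function.NonDependent.Propositional using (_×-↔_)
open import Data.Sum.Function.Propositional using (_⊎-↔_)
open import Function using (_∘_)
open import Function.Bundles using (_⇔_; mk⇔; _↔_; mk↔ₛ′; Inverse)
open import Function.Construct.Composition using (_↔-∘_; _⇔-∘_)
open import Function.Construct.Symmetry using (↔-sym)
open import Relation.Binary.PropositionalEquality
  using (_≡_; refl; sym; cong; subst)

-- Proof idea: the ZDD has one node (i , x) for every module Mᵢ and every message x it
-- may receive, labelled xᵢ; its lo/hi children are the nodes (i + 1 , Mᵢ(0, x)) and
-- (i + 1 , Mᵢ(1, x)), and for the last module the terminals named by the output bit.
-- The node (i , x) then represents exactly the sets on which the modules Mᵢ, …, Mₙ,
-- started with message x, output 1.  Layer i has 2^{aᵢ} nodes, which gives the bound.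

data Vertex (N : Set) : Set where
  ⊤ᵛ ⊥ᵛ : Vertex N
  node  : N → Vertex N

mapᵛ : {A B : Set} → (A → B) → Vertex A → Vertex B
mapᵛ f ⊤ᵛ       = ⊤ᵛ
mapᵛ f ⊥ᵛ       = ⊥ᵛ
mapᵛ f (node x) = node (f x)

fromBool : {N : Set} → Bool → Vertex N
fromBool true  = ⊤ᵛ
fromBool false = ⊥ᵛ

-- lo = child false, hi = child true.
record Diagram (n : ℕ) (N : Set) : Set where
  field
    label   : N → Fin n
    child   : Bool → N → Vertex N
    ordered : ∀ b x y → child b x ≡ node y → label x <ᶠ label y

open Diagram

data _∈[_]_ {n : ℕ} {N : Set} : Subset n → Diagram n N → Vertex N → Set where
  ∈-⊤  : ∀ {D} → ∅ ∈[ D ] ⊤ᵛ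
  ∈-lo : ∀ {D S x} → S ∈[ D ] child D false x → S ∈[ D ] node x
  ∈-hi : ∀ {D S x} → S ∈[ D ] child D true x → (⁅ label D x ⁆ ∪ S) ∈[ D ] node x

module Numbering {n k : ℕ} {N : Set} (D : Diagram n N) (e : N ↔ Fin k) (r : N) where
  open Inverse e using (to; from; strictlyInverseʳ)

  toNode : Vertex N → Node k
  toNode ⊤ᵛ       = ⊤ₙ
  toNode ⊥ᵛ       = ⊥ₙ
  toNode (node x) = int (to x)

  fromNode : Node k → Vertex N
  fromNode ⊤ₙ      = ⊤ᵛ
  fromNode ⊥ₙ      = ⊥ᵛ
  fromNode (int j) = node (from j)

  fromNode-toNode : ∀ ν → fromNode (toNode ν) ≡ ν
  fromNode-toNode ⊤ᵛ       = refl
  fromNode-toNode ⊥ᵛ       = refl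
  fromNode-toNode (node x) = cong node (strictlyInverseʳ x)

  toNode≡int : ∀ ν j → toNode ν ≡ int j → ν ≡ node (from j)
  toNode≡int ν j eq = subst (λ μ → ν ≡ fromNode μ) eq (sym (fromNode-toNode ν))

  zdd : ZDD n
  zdd = record
    { k          = k
    ; lb         = label D ∘ from
    ; lo         = toNode ∘ child D false ∘ from
    ; hi         = toNode ∘ child D true ∘ from
    ; root       = int (to r)
    ; lo-ordered = λ j j′ eq → ordered D false (from j) (from j′) (toNode≡int _ j′ eq)
    ; hi-ordered = λ j j′ eq → ordered D true (from j) (from j′) (toNode≡int _ j′ eq)
    }

  open ZDD zdd public using (_∈ₙ_; root)
  open ZDD zdd using (mem-⊤; mem-lo; mem-hi)

  ∈ₙ⇒∈ : ∀ {S ν} → S ∈ₙ ν → S ∈[ D ] fromNode ν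
  ∈ₙ⇒∈ mem-⊤ = ∈-⊤
  ∈ₙ⇒∈ {S} (mem-lo {j = j} p) =
    ∈-lo (subst (S ∈[ D ]_) (fromNode-toNode (child D false (from j))) (∈ₙ⇒∈ p))
  ∈ₙ⇒∈ (mem-hi {S} {j} p) =
    ∈-hi (subst (S ∈[ D ]_) (fromNode-toNode (child D true (from j))) (∈ₙ⇒∈ p))

  ∈⇒∈ₙ : ∀ {S ν} → S ∈[ D ] ν → S ∈ₙ toNode ν
  ∈⇒∈ₙ ∈-⊤ = mem-⊤
  ∈⇒∈ₙ (∈-lo {x = x} p) = lo-case (strictlyInverseʳ x) (∈⇒∈ₙ p)
    where
    lo-case : ∀ {y S} → from (to x) ≡ y → S ∈ₙ toNode (child D false y) → S ∈ₙ int (to x)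
    lo-case refl = mem-lo
  ∈⇒∈ₙ (∈-hi {x = x} p) = hi-case (strictlyInverseʳ x) (∈⇒∈ₙ p)
    where
    hi-case : ∀ {y S} → from (to x) ≡ y → S ∈ₙ toNode (child D true y) →
              (⁅ label D y ⁆ ∪ S) ∈ₙ int (to x)
    hi-case refl = mem-hi

  root-∈ : ∀ S → S ∈ₙ root ⇔ S ∈[ D ] node r
  root-∈ S = mk⇔ (subst (S ∈[ D ]_) (cong node (strictlyInverseʳ r)) ∘ ∈ₙ⇒∈) ∈⇒∈ₙ

emptyDiagram : Diagram 0 ⊥
emptyDiagram = record { label = λ () ; child = λ _ () ; ordered = λ _ () }

[]-∈-fromBool : ∀ {N} {D : Diagram 0 N} b → [] ∈[ D ] fromBool b ⇔ b ≡ true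
[]-∈-fromBool true  = mk⇔ (λ _ → refl) (λ _ → ∈-⊤)
[]-∈-fromBool false = mk⇔ (λ ()) (λ ())

prependLayer : ∀ {n N V} → (Bool → V → Vertex N) → Diagram n N →
               Diagram (suc n) (V ⊎ N)
prependLayer {n} {N} {V} step D = record
  { label   = label′
  ; child   = child′
  ; ordered = ordered′
  }
  where
  label′ : V ⊎ N → Fin (suc n)
  label′ = [ (λ _ → zero) , suc ∘ label D ]′

  child′ : Bool → V ⊎ N → Vertex (V ⊎ N)
  child′ b = [ mapᵛ inj₂ ∘ step b , mapᵛ inj₂ ∘ child D b ]′

  node-inj₂ : ∀ {ν : Vertex N} {w} → mapᵛ inj₂ ν ≡ node w → Σ N λ z → ν ≡ node z × w ≡ inj₂ z
  node-inj₂ {node z} refl = z , refl , refl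

  ordered′ : ∀ b x w → child′ b x ≡ node w → label′ x <ᶠ label′ w
  ordered′ b (inj₁ v) w eq with node-inj₂ eq
  ... | _ , _ , refl = z<s
  ordered′ b (inj₂ y) w eq with node-inj₂ eq
  ... | z , eq′ , refl = s<s (ordered D b y z eq′)

module _ {n : ℕ} {N V : Set} {step : Bool → V → Vertex N} {D : Diagram n N} where
  private
    P : Diagram (suc n) (V ⊎ N)
    P = prependLayer step D

  ∈-mapᵛ-inj₂ : ∀ {S ν} → S ∈[ D ] ν → (false ∷ S) ∈[ P ] mapᵛ inj₂ ν
  ∈-mapᵛ-inj₂ ∈-⊤      = ∈-⊤
  ∈-mapᵛ-inj₂ (∈-lo p) = ∈-lo (∈-mapᵛ-inj₂ p)
  ∈-mapᵛ-inj₂ (∈-hi p) = ∈-hi (∈-mapᵛ-inj₂ p)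

  ∈-mapᵛ-inj₂⁻ : ∀ {T ν} → T ∈[ P ] mapᵛ inj₂ ν → Σ (Subset n) λ S → T ≡ false ∷ S × S ∈[ D ] ν
  ∈-mapᵛ-inj₂⁻ {ν = ⊤ᵛ}     ∈-⊤      = _ , refl , ∈-⊤
  ∈-mapᵛ-inj₂⁻ {ν = node y} (∈-lo p) with ∈-mapᵛ-inj₂⁻ p
  ... | S , refl , q = S , refl , ∈-lo q
  ∈-mapᵛ-inj₂⁻ {ν = node y} (∈-hi p) with ∈-mapᵛ-inj₂⁻ p
  ... | S , refl , q = _ , refl , ∈-hi q

  ∈-first-layer⁻ : ∀ {T v} → T ∈[ P ] node (inj₁ v) → tail T ∈[ D ] step (head T) v
  ∈-first-layer⁻ (∈-lo p) with ∈-mapᵛ-inj₂⁻ p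
  ... | _ , refl , q = q
  ∈-first-layer⁻ (∈-hi p) with ∈-mapᵛ-inj₂⁻ p
  ... | S , refl , q = subst (_∈[ D ] _) (sym (∪-identityˡ S)) q

  ∈-first-layer : ∀ {b S v} → (b ∷ S) ∈[ P ] node (inj₁ v) ⇔ S ∈[ D ] step b v
  ∈-first-layer {b} {S} = mk⇔ ∈-first-layer⁻ (from b)
    where
    from : ∀ b {v} → S ∈[ D ] step b v → (b ∷ S) ∈[ P ] node (inj₁ v)
    from false p = ∈-lo (∈-mapᵛ-inj₂ p)
    from true  p = subst (λ T → (true ∷ T) ∈[ P ] _) (∪-identityˡ S) (∈-hi (∈-mapᵛ-inj₂ p))

-- The paper's node (i , x) is x in the i-th summand.
Layers : (n : ℕ) → (Fin n → ℕ) → Set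
Layers zero    a = ⊥
Layers (suc n) a = Vec Bool (a zero) ⊎ Layers n (a ∘ suc)

Vec-Bool↔Fin : ∀ n → Vec Bool n ↔ Fin (2 ^ n)
Vec-Bool↔Fin zero    = mk↔ₛ′ (λ _ → zero) (λ _ → []) (λ { zero → refl }) (λ { [] → refl })
Vec-Bool↔Fin (suc n) =
  ↔-sym *↔× ↔-∘ ((↔-sym 2↔Bool ×-↔ Vec-Bool↔Fin n) ↔-∘ uncons↔)
  where
  uncons↔ : Vec Bool (suc n) ↔ (Bool × Vec Bool n)
  uncons↔ = mk↔ₛ′ uncons (uncurry _∷_) (λ _ → refl) (λ { (_ ∷ _) → refl })

Layers↔Fin : ∀ n a → Layers n a ↔ Fin (sumPow2 a)
Layers↔Fin zero    a = ↔-sym 0↔⊥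
Layers↔Fin (suc n) a = ↔-sym +↔⊎ ↔-∘ (Vec-Bool↔Fin (a zero) ⊎-↔ Layers↔Fin n (a ∘ suc))

network : ∀ m a → Modules a → Diagram (suc m) (Layers (suc m) a)
network zero    a M = prependLayer (λ s x → fromBool (M zero s x)) emptyDiagram
network (suc m) a M =
  prependLayer (λ s x → node (inj₁ (M zero s x))) (network m (a ∘ suc) (M ∘ suc))

network-accepts : ∀ m a M S x → S ∈[ network m a M ] node (inj₁ x) ⇔ runFrom m a M S x ≡ true
network-accepts zero    a M (s ∷ []) x = []-∈-fromBool (M zero s x) ⇔-∘ ∈-first-layer
network-accepts (suc m) a M (s ∷ S) x =
  network-accepts m (a ∘ suc) (M ∘ suc) S (M zero s x) ⇔-∘ ∈-first-layer

lemma15 : (m : ℕ) (𝓕 : Family (suc m)) (a : Fin (suc m) → ℕ)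
            (a₀ : a zero ≡ 0) (M : Modules a) →
            Decides m a a₀ M 𝓕 →
            ZSize≤ 𝓕 (2 + sumPow2 a)
lemma15 m 𝓕 a a₀ M decides = zdd , represents , ≤-reflexive (+-comm (sumPow2 a) 2)
  where
  x₀ : Vec Bool (a zero)
  x₀ = subst (Vec Bool) (sym a₀) []

  open Numbering (network m a M) (Layers↔Fin (suc m) a) (inj₁ x₀)

  represents : Represents zdd 𝓕
  represents S = subst (λ b → S ∈ₙ root ⇔ b ≡ true) (decides S)
    (network-accepts m a M S x₀ ⇔-∘ root-∈ S)
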